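{- For all positive integers $l,s,m$ there exist directed strongly regular graphs with parameters \[\big(m(ls^2+s),\ mls,\ ml,\ m(l-1),\ ml\big)\] and \[\big(m(ls^2+s),\ m(ls+s)-1,\ m(l+s)-1,\ m(l+s)-2,\ m(l+1)\big).\]
   Context: A directed strongly regular graph with parameters $(v,k,t,\lambda,\mu)$ is a loopless directed graph on $v$ vertices with adjacency matrix $A$ satisfying $AJ=JA=kJ$ and $A^2=tI+\lambda A+\mu(J-I-A)$, where $I$ is the identity and $J$ the all-ones matrix. -}

module Defs where

open import Data.Nat using (ℕ; zero; suc; _+_)
open import Data.Bool using (Bool; true; false; if_then_else_)
open import Data.Fin using (Fin)
open import Data.Vec.Functional using (Vector; foldr)
open import Relation.Binary.PropositionalEquality using (_≡_; _≢_)
open import Data.Product using (_×_)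

-- A directed graph on the vertex set Fin v, given by its 0/1 adjacency matrix
-- (A x y = true iff there is an arc x → y).
Digraph : ℕ → Set
Digraph v = Fin v → Fin v → Bool

entry : Bool → ℕ
entry true  = 1
entry false = 0

Σ-Fin : (v : ℕ) → (Fin v → ℕ) → ℕ
Σ-Fin v f = foldr _+_ 0 f

-- (A J)_x = out-degree, (J A)_y = in-degree
outDeg : ∀ {v} → Digraph v → Fin v → ℕ
outDeg {v} A x = Σ-Fin v (λ z → entry (A x z))

inDeg : ∀ {v} → Digraph v → Fin v → ℕ
inDeg {v} A y = Σ-Fin v (λ z → entry (A z y))

sq : ∀ {v} → Digraph v → Fin v → Fin v → ℕ
sq {v} A x y = Σ-Fin v (λ z → entry (A x z) ℕ.* entry (A z y))
  where import Data.Nat as ℕ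

-- Directed strongly regular graph with parameters (v,k,t,λ,μ):
-- loopless, AJ = JA = kJ, and A² = tI + λA + μ(J − I − A), checked entrywise.
record IsDSRG (v k t λ' μ : ℕ) (A : Digraph v) : Set where
  field
    loopless : ∀ x → A x x ≡ false
    outReg   : ∀ x → outDeg A x ≡ k
    inReg    : ∀ y → inDeg A y ≡ k
    diagSq   : ∀ x → sq A x x ≡ t
    offSq    : ∀ x y → x ≢ y → sq A x y ≡ (if A x y then λ' else μ)

DSRG-exists : (v k t λ' μ : ℕ) → Set
DSRG-exists v k t λ' μ = Data.Product.Σ (Digraph v) (IsDSRG v k t λ' μ)
  where import Data.Product

module Submission where

-- Take N = ls + 1 points.  A uniform colouring of order (l, s)
-- assigns, for every point a, one of s colours to each of the other ls points,
-- every colour being used exactly l times.  Blow every point up into m·s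
-- vertices (copy, point, colour) and let (p, a, j) → (q, b, j') iff b has colour
-- j as seen from a.  Writing A for this adjacency matrix and F for the matrix of
-- "same point", summing over a colour class and then over all classes gives
--   A² + mA = ml J,   AF = ms A,   FA + mF = m J,   F² = ms F,
-- so A is a DSRG(m(ls²+s), mls, ml, m(l−1), ml).  The second graph has matrix
-- B = A + F − I; expanding (B + I)² = (A + F)² with the four identities gives
--   B² = m(l+1) J + (ms − m − 2) B + (ms − m − 1) I,
-- which is the second parameter set.

open import Defs
open import Data.Nat using (ℕ; zero; suc; _+_; _*_; _∸_; NonZero)
open import Data.Nat.Properties
  using ( +-*-semiring; +-assoc; +-comm; *-comm; *-assoc; *-identityˡ; *-identityʳ; *-zeroʳ
        ; *-distribˡ-+; *-distribˡ-∸; +-identityʳ; +-cancelʳ-≡; m+n∸n≡m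
        ; m+n≡0⇒m≡0; m+n≡0⇒n≡0 )
open import Data.Nat.Tactic.RingSolver using (solve-∀)
open import Data.Bool using (Bool; true; false; _∨_; _∧_; not; if_then_else_)
open import Data.Bool.Properties using (∨-identityʳ)
open import Data.Fin using (Fin; zero; suc; punchIn; punchOut; combine; remQuot; _↑ˡ_; _↑ʳ_; _≟_)
open import Data.Fin.Properties using (punchInᵢ≢i; punchOut-punchIn; punchOut-cong; remQuot-combine)
open import Data.Product using (_×_; _,_; proj₁; proj₂; uncurry)
open import Relation.Binary.PropositionalEquality
open import Relation.Nullary using (Dec; yes; no; does)
open import Data.Empty using (⊥-elim)
open import Algebra.Properties.Semiring.Sum +-*-semiring
  using (sum; sum-cong-≗; ∑-distrib-+; sum-remove; *-distribˡ-sum)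

-- Finite sums over Fin n (Σ-Fin of Defs is the library's `sum`)

Σ-const : ∀ n c → sum {n} (λ _ → c) ≡ n * c
Σ-const zero    c = refl
Σ-const (suc n) c = cong (c +_) (Σ-const n c)

Σ-*ˡ : ∀ {n} c (f : Fin n → ℕ) → sum (λ i → c * f i) ≡ c * sum f
Σ-*ˡ c f = sym (*-distribˡ-sum c f)

Σ≡0⇒≡0 : ∀ {n} (f : Fin n → ℕ) → sum f ≡ 0 → ∀ i → f i ≡ 0
Σ≡0⇒≡0 f h zero    = m+n≡0⇒m≡0 (f zero) h
Σ≡0⇒≡0 f h (suc i) = Σ≡0⇒≡0 (λ i → f (suc i)) (m+n≡0⇒n≡0 (f zero) h) i

Σ-split : ∀ {n} (f g h k : Fin n → ℕ) → (∀ i → f i + g i ≡ h i + k i) →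
          sum f + sum g ≡ sum h + sum k
Σ-split f g h k e = trans (sym (∑-distrib-+ f g)) (trans (sum-cong-≗ e) (∑-distrib-+ h k))

Σ-++ : ∀ a {b} (f : Fin (a + b) → ℕ) →
       sum f ≡ sum {a} (λ i → f (i ↑ˡ b)) + sum {b} (λ i → f (a ↑ʳ i))
Σ-++ zero    f = refl
Σ-++ (suc a) f = trans (cong (f zero +_) (Σ-++ a (λ i → f (suc i)))) (sym (+-assoc (f zero) _ _))

Σ-combine : ∀ m {n} (f : Fin (m * n) → ℕ) →
            sum f ≡ sum {m} (λ i → sum {n} (λ j → f (combine i j)))
Σ-combine zero        f = refl
Σ-combine (suc m) {n} f =
  trans (Σ-++ n {m * n} f)
        (cong (sum {n} (λ j → f (j ↑ˡ (m * n))) +_) (Σ-combine m {n} (λ i → f (n ↑ʳ i))))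

Σ-remQuot : ∀ m {n} (g : Fin m → Fin n → ℕ) →
            sum (λ z → uncurry g (remQuot {m} n z)) ≡ sum (λ i → sum (g i))
Σ-remQuot m {n} g = trans (Σ-combine m {n} (λ z → uncurry g (remQuot {m} n z)))
  (sum-cong-≗ (λ i → sum-cong-≗ (λ j → cong (uncurry g) (remQuot-combine i j))))

δ : ∀ {n} → Fin n → Fin n → ℕ
δ a b = entry (does (a ≟ b))

δ-refl : ∀ {n} (a : Fin n) → δ a a ≡ 1
δ-refl a with a ≟ a
... | yes _   = refl
... | no a≢a = ⊥-elim (a≢a refl)

δ-≢ : ∀ {n} {a b : Fin n} → a ≢ b → δ a b ≡ 0
δ-≢ {a = a} {b} a≢b with a ≟ b
... | yes a≡b = ⊥-elim (a≢b a≡b)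
... | no _    = refl

δ-sym : ∀ {n} (a b : Fin n) → δ a b ≡ δ b a
δ-sym a b with a ≟ b | b ≟ a
... | yes _   | yes _   = refl
... | no _    | no _    = refl
... | yes a≡b | no b≢a = ⊥-elim (b≢a (sym a≡b))
... | no a≢b  | yes b≡a = ⊥-elim (a≢b (sym b≡a))

Σ-δ-mulˡ : ∀ {n} (a : Fin n) (f : Fin n → ℕ) → sum (λ b → δ a b * f b) ≡ f a
Σ-δ-mulˡ {suc n} a f = begin
  sum (λ b → δ a b * f b)
    ≡⟨ sum-remove {i = a} (λ b → δ a b * f b) ⟩
  δ a a * f a + sum (λ c → δ a (punchIn a c) * f (punchIn a c))
    ≡⟨ cong₂ _+_ (cong (_* f a) (δ-refl a))
                 (sum-cong-≗ (λ c → cong (_* f (punchIn a c)) (δ-≢ (λ e → punchInᵢ≢i a c (sym e))))) ⟩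
  1 * f a + sum {n} (λ _ → 0)
    ≡⟨ cong₂ _+_ (*-identityˡ (f a)) (trans (Σ-const n 0) (*-zeroʳ n)) ⟩
  f a + 0
    ≡⟨ +-identityʳ (f a) ⟩
  f a ∎
  where open ≡-Reasoning

Σ-δ-mulʳ : ∀ {n} (a : Fin n) (f : Fin n → ℕ) → sum (λ b → f b * δ b a) ≡ f a
Σ-δ-mulʳ a f =
  trans (sum-cong-≗ (λ b → trans (*-comm (f b) (δ b a)) (cong (_* f b) (δ-sym b a)))) (Σ-δ-mulˡ a f)

Σ-δ : ∀ {n} (a : Fin n) → sum (δ a) ≡ 1
Σ-δ a = trans (sum-cong-≗ (λ b → sym (*-identityʳ (δ a b)))) (Σ-δ-mulˡ a (λ _ → 1))

Σ-δᵀ : ∀ {n} (a : Fin n) → sum (λ b → δ b a) ≡ 1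
Σ-δᵀ a = trans (sum-cong-≗ (λ b → δ-sym b a)) (Σ-δ a)

Mat : ℕ → Set
Mat v = Fin v → Fin v → ℕ

adj : ∀ {v} → Digraph v → Mat v
adj G x y = entry (G x y)

_*ᴹ_ : ∀ {v} → Mat v → Mat v → Mat v
(M *ᴹ N) x y = sum (λ z → M x z * N z y)

*ᴹ-expand : ∀ {v} (M N P Q : Mat v) x y →
  sum (λ z → (M x z + N x z) * (P z y + Q z y)) ≡
  (M *ᴹ P) x y + (M *ᴹ Q) x y + ((N *ᴹ P) x y + (N *ᴹ Q) x y)
*ᴹ-expand M N P Q x y = begin
  sum (λ z → (M x z + N x z) * (P z y + Q z y))
    ≡⟨ sum-cong-≗ (λ z → expand (M x z) (N x z) (P z y) (Q z y)) ⟩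
  sum (λ z → (M x z * P z y + M x z * Q z y) + (N x z * P z y + N x z * Q z y))
    ≡⟨ ∑-distrib-+ (λ z → M x z * P z y + M x z * Q z y) (λ z → N x z * P z y + N x z * Q z y) ⟩
  sum (λ z → M x z * P z y + M x z * Q z y) + sum (λ z → N x z * P z y + N x z * Q z y)
    ≡⟨ cong₂ _+_ (∑-distrib-+ (λ z → M x z * P z y) (λ z → M x z * Q z y))
                 (∑-distrib-+ (λ z → N x z * P z y) (λ z → N x z * Q z y)) ⟩
  (M *ᴹ P) x y + (M *ᴹ Q) x y + ((N *ᴹ P) x y + (N *ᴹ Q) x y) ∎
  where
  open ≡-Reasoning
  expand : ∀ a b c d → (a + b) * (c + d) ≡ (a * c + a * d) + (b * c + b * d)
  expand = solve-∀

entry≡0⇒false : ∀ b → entry b ≡ 0 → b ≡ false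
entry≡0⇒false false _ = refl

entry-not : ∀ b → entry (not b) + entry b ≡ 1
entry-not true  = refl
entry-not false = refl

cancel-∸ : ∀ {q} k {r} → q + k ≡ r → q ≡ r ∸ k
cancel-∸ {q} k h = trans (sym (m+n∸n≡m q k)) (cong (_∸ k) h)

-- The entries of A² for the first graph, from A² + mA = ml J.
firstSquare : ∀ m l (b : Bool) q → q + m * entry b ≡ m * l →
              q ≡ (if b then m * (l ∸ 1) else m * l)
firstSquare m l true  q h = begin
  q                 ≡⟨ cancel-∸ m (trans (cong (q +_) (sym (*-identityʳ m))) h) ⟩
  m * l ∸ m         ≡⟨ cong (m * l ∸_) (sym (*-identityʳ m)) ⟩
  m * l ∸ m * 1     ≡⟨ sym (*-distribˡ-∸ m l 1) ⟩
  m * (l ∸ 1)       ∎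
  where open ≡-Reasoning
firstSquare m l false q h = trans (sym (+-identityʳ q)) (trans (cong (q +_) (sym (*-zeroʳ m))) h)

-- One entry of the matrix identity B² + 2B + I + m(B + I) = m(l + 1)J + ms(B + I),
-- where q, e, d are the entries of B², B and I.
SecondSquare : (m l s q e d : ℕ) → Set
SecondSquare m l s q e d = q + e + (e + d) + m * (e + d) ≡ m * l + m + m * (s * (e + d))

-- Bookkeeping for (B + I)² = (A + F)²: with a = A_xy, f = F_xy and aa, af, fa, ff
-- the entries of A², AF, FA, F², the four product identities give SecondSquare.
squareOfSum : ∀ m l s q e d a f aa af fa ff →
  aa + m * a ≡ m * l → af ≡ m * (s * a) → fa + m * f ≡ m → ff ≡ m * (s * f) →
  a + f ≡ e + d → q + e + (e + d) ≡ aa + af + (fa + ff) → SecondSquare m l s q e d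
squareOfSum m l s q e d a f aa .(m * (s * a)) fa .(m * (s * f)) hAA refl hFA refl a+f≡e+d hq = begin
  q + e + (e + d) + m * (e + d)
    ≡⟨ cong₂ (λ u w → u + m * w) hq (sym a+f≡e+d) ⟩
  aa + m * (s * a) + (fa + m * (s * f)) + m * (a + f)
    ≡⟨ regroup aa fa m s a f ⟩
  (aa + m * a) + (fa + m * f) + m * (s * (a + f))
    ≡⟨ cong₂ (λ u w → u + w + m * (s * (a + f))) hAA hFA ⟩
  m * l + m + m * (s * (a + f))
    ≡⟨ cong (λ w → m * l + m + m * (s * w)) a+f≡e+d ⟩
  m * l + m + m * (s * (e + d)) ∎
  where
  open ≡-Reasoning
  regroup : ∀ aa fa m s a f → aa + m * (s * a) + (fa + m * (s * f)) + m * (a + f) ≡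
            (aa + m * a) + (fa + m * f) + m * (s * (a + f))
  regroup = solve-∀

secondSquareDiag : ∀ m l s q e d → e ≡ 0 → d ≡ 1 → SecondSquare m l s q e d → q ≡ m * (l + s) ∸ 1
secondSquareDiag m l s q .0 .1 refl refl h =
  cancel-∸ 1 (+-cancelʳ-≡ m (q + 1) (m * (l + s)) (trans (lhs q m) (trans h (rhs m l s))))
  where
  lhs : ∀ q m → q + 1 + m ≡ q + 0 + (0 + 1) + m * (0 + 1)
  lhs = solve-∀
  rhs : ∀ m l s → m * l + m + m * (s * (0 + 1)) ≡ m * (l + s) + m
  rhs = solve-∀

secondSquareOff : ∀ m l s q (b : Bool) d → d ≡ 0 → SecondSquare m l s q (entry b) d →
  q ≡ (if b then m * (l + s) ∸ 2 else m * (l + 1))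
secondSquareOff m l s q true .0 refl h =
  cancel-∸ 2 (+-cancelʳ-≡ m (q + 2) (m * (l + s)) (trans (lhs q m) (trans h (rhs m l s))))
  where
  lhs : ∀ q m → q + 2 + m ≡ q + 1 + (1 + 0) + m * (1 + 0)
  lhs = solve-∀
  rhs : ∀ m l s → m * l + m + m * (s * (1 + 0)) ≡ m * (l + s) + m
  rhs = solve-∀
secondSquareOff m l s q false .0 refl h = trans (lhs q m) (trans h (rhs m l s))
  where
  lhs : ∀ q m → q ≡ q + 0 + (0 + 0) + m * (0 + 0)
  lhs = solve-∀
  rhs : ∀ m l s → m * l + m + m * (s * (0 + 0)) ≡ m * (l + 1)
  rhs = solve-∀

Points : ℕ → ℕ → Set
Points l s = Fin (suc (l * s))

-- `colour a j b`: seen from a, the point b has colour j.  Every colour class of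
-- every point has l elements, and the classes of a partition the points ≠ a.
record UniformColouring (l s : ℕ) : Set where
  field
    colour    : Points l s → Fin s → Points l s → Bool
    classSize : ∀ a j → sum (λ b → entry (colour a j b)) ≡ l
    partition : ∀ a b → sum (λ j → entry (colour a j b)) + δ a b ≡ 1

module ColouringFacts {l s : ℕ} (C : UniformColouring l s) where
  open UniformColouring C

  noSelfColour : ∀ a j → colour a j a ≡ false
  noSelfColour a j = entry≡0⇒false (colour a j a)
    (Σ≡0⇒≡0 (λ j → entry (colour a j a))
      (+-cancelʳ-≡ 1 _ 0 (trans (cong (_ +_) (sym (δ-refl a))) (partition a a))) j)

  -- Summing a weight f over all (b, j) with c in class j of b counts every b ≠ c once.
  Σ-classes : ∀ (f : Points l s → ℕ) c →
    sum (λ b → sum (λ j → f b * entry (colour b j c))) + f c ≡ sum f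
  Σ-classes f c = begin
    sum (λ b → sum (λ j → f b * entry (colour b j c))) + f c
      ≡⟨ cong₂ _+_ (sum-cong-≗ (λ b → Σ-*ˡ (f b) (λ j → entry (colour b j c)))) (sym (Σ-δ-mulʳ c f)) ⟩
    sum (λ b → f b * sum (λ j → entry (colour b j c))) + sum (λ b → f b * δ b c)
      ≡⟨ sym (∑-distrib-+ (λ b → f b * sum (λ j → entry (colour b j c))) (λ b → f b * δ b c)) ⟩
    sum (λ b → f b * sum (λ j → entry (colour b j c)) + f b * δ b c)
      ≡⟨ sum-cong-≗ (λ b → trans (sym (*-distribˡ-+ (f b) (sum (λ j → entry (colour b j c))) (δ b c)))
                            (trans (cong (f b *_) (partition b c)) (*-identityʳ (f b)))) ⟩
    sum f ∎
    where open ≡-Reasoning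

  classesContaining : ∀ c → sum (λ b → sum (λ j → entry (colour b j c))) ≡ l * s
  classesContaining c = +-cancelʳ-≡ 1 _ (l * s) (begin
    sum (λ b → sum (λ j → entry (colour b j c))) + 1
      ≡⟨ cong (_+ 1) (sum-cong-≗ (λ b → sum-cong-≗ (λ j → sym (*-identityˡ (entry (colour b j c)))))) ⟩
    sum (λ b → sum (λ j → 1 * entry (colour b j c))) + 1
      ≡⟨ Σ-classes (λ _ → 1) c ⟩
    sum {suc (l * s)} (λ _ → 1)
      ≡⟨ trans (Σ-const (suc (l * s)) 1) (*-identityʳ (suc (l * s))) ⟩
    suc (l * s)
      ≡⟨ +-comm 1 (l * s) ⟩
    l * s + 1 ∎)
    where open ≡-Reasoning

module Lift {l s : ℕ} (C : UniformColouring l s) (m : ℕ) where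
  open UniformColouring C
  open ColouringFacts C

  -- Vertices are the triples (copy, point, colour), encoded in Fin V.
  V : ℕ
  V = m * (suc (l * s) * s)

  pointColour : Fin V → Points l s × Fin s
  pointColour z = remQuot {suc (l * s)} s (proj₂ (remQuot {m} (suc (l * s) * s) z))

  pt : Fin V → Points l s
  pt z = proj₁ (pointColour z)

  col : Fin V → Fin s
  col z = proj₂ (pointColour z)

  -- Each (point, colour) pair is carried by exactly m vertices.
  Σ-lift : ∀ (g : Points l s → Fin s → ℕ) → sum (λ z → g (pt z) (col z)) ≡ m * sum (λ a → sum (g a))
  Σ-lift g = begin
    sum (λ z → g (pt z) (col z))
      ≡⟨ Σ-remQuot m (λ _ w → uncurry g (remQuot {suc (l * s)} s w)) ⟩
    sum {m} (λ _ → sum (λ w → uncurry g (remQuot {suc (l * s)} s w)))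
      ≡⟨ Σ-const m _ ⟩
    m * sum (λ w → uncurry g (remQuot {suc (l * s)} s w))
      ≡⟨ cong (m *_) (Σ-remQuot (suc (l * s)) g) ⟩
    m * sum (λ a → sum (g a)) ∎
    where open ≡-Reasoning

  Σ-liftPoint : ∀ (f : Points l s → ℕ) → sum (λ z → f (pt z)) ≡ m * (s * sum f)
  Σ-liftPoint f = trans (Σ-lift (λ a _ → f a))
    (cong (m *_) (trans (sum-cong-≗ (λ a → Σ-const s (f a))) (Σ-*ˡ s f)))

  G₁ : Digraph V
  G₁ x y = colour (pt x) (col x) (pt y)

  A : Mat V
  A = adj G₁

  -- The matrix of "same point"; it is J_m ⊗ I_N ⊗ J_s.
  F : Mat V
  F x y = δ (pt x) (pt y)

  rowTimesA : ∀ (f : Points l s → ℕ) y → sum (λ z → f (pt z) * A z y) + m * f (pt y) ≡ m * sum f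
  rowTimesA f y = begin
    sum (λ z → f (pt z) * A z y) + m * f c
      ≡⟨ cong (_+ m * f c) (Σ-lift (λ b j → f b * entry (colour b j c))) ⟩
    m * sum (λ b → sum (λ j → f b * entry (colour b j c))) + m * f c
      ≡⟨ sym (*-distribˡ-+ m _ _) ⟩
    m * (sum (λ b → sum (λ j → f b * entry (colour b j c))) + f c)
      ≡⟨ cong (m *_) (Σ-classes f c) ⟩
    m * sum f ∎
    where
    open ≡-Reasoning
    c = pt y

  rowTimesF : ∀ (f : Points l s → ℕ) y → sum (λ z → f (pt z) * F z y) ≡ m * (s * f (pt y))
  rowTimesF f y = trans (Σ-liftPoint (λ b → f b * δ b (pt y))) (cong (λ t → m * (s * t)) (Σ-δ-mulʳ (pt y) f))

  A²+mA : ∀ x y → (A *ᴹ A) x y + m * A x y ≡ m * l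
  A²+mA x y = trans (rowTimesA (λ b → entry (colour (pt x) (col x) b)) y) (cong (m *_) (classSize (pt x) (col x)))

  AF : ∀ x y → (A *ᴹ F) x y ≡ m * (s * A x y)
  AF x y = rowTimesF (λ b → entry (colour (pt x) (col x) b)) y

  FA+mF : ∀ x y → (F *ᴹ A) x y + m * F x y ≡ m
  FA+mF x y = trans (rowTimesA (δ (pt x)) y) (trans (cong (m *_) (Σ-δ (pt x))) (*-identityʳ m))

  F² : ∀ x y → (F *ᴹ F) x y ≡ m * (s * F x y)
  F² x y = rowTimesF (δ (pt x)) y

  outA : ∀ x → sum (A x) ≡ m * (s * l)
  outA x = trans (Σ-liftPoint (λ b → entry (colour (pt x) (col x) b))) (cong (λ t → m * (s * t)) (classSize (pt x) (col x)))

  inA : ∀ y → sum (λ z → A z y) ≡ m * (l * s)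
  inA y = trans (Σ-lift (λ b j → entry (colour b j (pt y)))) (cong (m *_) (classesContaining (pt y)))

  outF : ∀ x → sum (F x) ≡ m * (s * 1)
  outF x = trans (Σ-liftPoint (δ (pt x))) (cong (λ t → m * (s * t)) (Σ-δ (pt x)))

  inF : ∀ y → sum (λ z → F z y) ≡ m * (s * 1)
  inF y = trans (Σ-liftPoint (λ b → δ b (pt y))) (cong (λ t → m * (s * t)) (Σ-δᵀ (pt y)))

  isDSRG₁ : IsDSRG V (m * l * s) (m * l) (m * (l ∸ 1)) (m * l) G₁
  isDSRG₁ = record
    { loopless = λ x → noSelfColour (pt x) (col x)
    ; outReg   = λ x → trans (outA x) (reorder m s l)
    ; inReg    = λ y → trans (inA y) (sym (*-assoc m l s))
    ; diagSq   = λ x → firstSquare m l false (sq G₁ x x)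
                   (trans (cong (λ b → sq G₁ x x + m * entry b) (sym (noSelfColour (pt x) (col x)))) (A²+mA x x))
    ; offSq    = λ x y _ → firstSquare m l (G₁ x y) (sq G₁ x y) (A²+mA x y)
    }
    where
    reorder : ∀ m s l → m * (s * l) ≡ m * l * s
    reorder = solve-∀

  G₂ : Digraph V
  G₂ x y = G₁ x y ∨ (does (pt x ≟ pt y) ∧ not (does (x ≟ y)))

  B : Mat V
  B = adj G₂

  B+I : ∀ x y → B x y + δ x y ≡ A x y + F x y
  B+I x y = bySamePoint (pt x ≟ pt y)
    where
    bySamePoint : (d : Dec (pt x ≡ pt y)) →
      entry (G₁ x y ∨ (does d ∧ not (does (x ≟ y)))) + δ x y ≡ A x y + entry (does d)
    bySamePoint (yes same) = begin
      entry (G₁ x y ∨ not (does (x ≟ y))) + δ x y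
        ≡⟨ cong (λ b → entry (b ∨ not (does (x ≟ y))) + δ x y) noArc ⟩
      entry (not (does (x ≟ y))) + δ x y
        ≡⟨ entry-not (does (x ≟ y)) ⟩
      entry false + 1
        ≡⟨ cong (λ b → entry b + 1) (sym noArc) ⟩
      A x y + 1 ∎
      where
      open ≡-Reasoning
      noArc : G₁ x y ≡ false
      noArc = trans (cong (colour (pt x) (col x)) (sym same)) (noSelfColour (pt x) (col x))
    bySamePoint (no different) =
      cong₂ _+_ (cong entry (∨-identityʳ (G₁ x y))) (δ-≢ (λ x≡y → different (cong pt x≡y)))

  loopless₂ : ∀ x → G₂ x x ≡ false
  loopless₂ x = entry≡0⇒false (G₂ x x) (+-cancelʳ-≡ 1 (B x x) 0 (begin
    B x x + 1        ≡⟨ cong (B x x +_) (sym (δ-refl x)) ⟩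
    B x x + δ x x    ≡⟨ B+I x x ⟩
    A x x + F x x    ≡⟨ cong₂ _+_ (cong entry (noSelfColour (pt x) (col x))) (δ-refl (pt x)) ⟩
    1 ∎))
    where open ≡-Reasoning

  outB : ∀ x → sum (B x) + 1 ≡ sum (A x) + sum (F x)
  outB x = trans (cong (sum (B x) +_) (sym (Σ-δ x))) (Σ-split (B x) (δ x) (A x) (F x) (B+I x))

  inB : ∀ y → sum (λ z → B z y) + 1 ≡ sum (λ z → A z y) + sum (λ z → F z y)
  inB y = trans (cong (sum (λ z → B z y) +_) (sym (Σ-δᵀ y)))
    (Σ-split (λ z → B z y) (λ z → δ z y) (λ z → A z y) (λ z → F z y) (λ z → B+I z y))

  B²-identity : ∀ x y → SecondSquare m l s (sq G₂ x y) (B x y) (δ x y)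
  B²-identity x y = squareOfSum m l s (sq G₂ x y) (B x y) (δ x y) (A x y) (F x y) _ _ _ _
    (A²+mA x y) (AF x y) (FA+mF x y) (F² x y) (sym (B+I x y)) (begin
      sq G₂ x y + B x y + (B x y + δ x y)
        ≡⟨ cong₂ (λ u w → sq G₂ x y + u + w) (sym (Σ-δ-mulʳ y (B x)))
                 (cong₂ _+_ (sym (Σ-δ-mulˡ x (λ z → B z y))) (sym (Σ-δ-mulˡ x (λ z → δ z y)))) ⟩
      (B *ᴹ B) x y + (B *ᴹ δ) x y + ((δ *ᴹ B) x y + (δ *ᴹ δ) x y)
        ≡⟨ sym (*ᴹ-expand B δ B δ x y) ⟩
      sum (λ z → (B x z + δ x z) * (B z y + δ z y))
        ≡⟨ sum-cong-≗ (λ z → cong₂ _*_ (B+I x z) (B+I z y)) ⟩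
      sum (λ z → (A x z + F x z) * (A z y + F z y))
        ≡⟨ *ᴹ-expand A F A F x y ⟩
      (A *ᴹ A) x y + (A *ᴹ F) x y + ((F *ᴹ A) x y + (F *ᴹ F) x y) ∎)
    where open ≡-Reasoning

  isDSRG₂ : IsDSRG V (m * (l * s + s) ∸ 1) (m * (l + s) ∸ 1) (m * (l + s) ∸ 2) (m * (l + 1)) G₂
  isDSRG₂ = record
    { loopless = loopless₂
    ; outReg   = λ x → cancel-∸ 1 (trans (outB x) (trans (cong₂ _+_ (outA x) (outF x)) (outDegree m l s)))
    ; inReg    = λ y → cancel-∸ 1 (trans (inB y) (trans (cong₂ _+_ (inA y) (inF y)) (inDegree m l s)))
    ; diagSq   = λ x → secondSquareDiag m l s _ _ _ (cong entry (loopless₂ x)) (δ-refl x) (B²-identity x x)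
    ; offSq    = λ x y x≢y → secondSquareOff m l s _ (G₂ x y) _ (δ-≢ x≢y) (B²-identity x y)
    }
    where
    outDegree : ∀ m l s → m * (s * l) + m * (s * 1) ≡ m * (l * s + s)
    outDegree = solve-∀
    inDegree : ∀ m l s → m * (l * s) + m * (s * 1) ≡ m * (l * s + s)
    inDegree = solve-∀

-- Seen from a, the other ls points are numbered by punchOut and arranged in an
-- l × s grid; a point gets the colour of its column.
module GridColouring (l s : ℕ) where

  column : Fin (l * s) → Fin s
  column c = proj₂ (remQuot {l} s c)

  colourOf : ∀ {a b : Points l s} → Dec (a ≡ b) → Fin s → Bool
  colourOf (yes _)   j = false
  colourOf (no a≢b) j = does (column (punchOut a≢b) ≟ j)

  colour : Points l s → Fin s → Points l s → Bool
  colour a j b = colourOf (a ≟ b) j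

  colour-self : ∀ a j → colour a j a ≡ false
  colour-self a j with a ≟ a
  ... | yes _   = refl
  ... | no a≢a = ⊥-elim (a≢a refl)

  colour-punchIn : ∀ a c j → entry (colour a j (punchIn a c)) ≡ δ (column c) j
  colour-punchIn a c j = byDistinct (a ≟ punchIn a c)
    where
    byDistinct : (d : Dec (a ≡ punchIn a c)) → entry (colourOf d j) ≡ δ (column c) j
    byDistinct (yes a≡c) = ⊥-elim (punchInᵢ≢i a c (sym a≡c))
    byDistinct (no a≢c)  = cong (λ z → δ (column z) j) (trans (punchOut-cong a refl) (punchOut-punchIn a))

  classSize : ∀ a j → sum (λ b → entry (colour a j b)) ≡ l
  classSize a j = begin
    sum (λ b → entry (colour a j b))
      ≡⟨ sum-remove {i = a} (λ b → entry (colour a j b)) ⟩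
    entry (colour a j a) + sum (λ c → entry (colour a j (punchIn a c)))
      ≡⟨ cong₂ _+_ (cong entry (colour-self a j)) (sum-cong-≗ (λ c → colour-punchIn a c j)) ⟩
    sum (λ c → δ (column c) j)
      ≡⟨ Σ-remQuot l (λ _ j′ → δ j′ j) ⟩
    sum {l} (λ _ → sum (λ j′ → δ j′ j))
      ≡⟨ sum-cong-≗ {l} (λ _ → Σ-δᵀ j) ⟩
    sum {l} (λ _ → 1)
      ≡⟨ trans (Σ-const l 1) (*-identityʳ l) ⟩
    l ∎
    where open ≡-Reasoning

  partition : ∀ a b → sum (λ j → entry (colour a j b)) + δ a b ≡ 1
  partition a b = byDistinct (a ≟ b)
    where
    byDistinct : (d : Dec (a ≡ b)) → sum (λ j → entry (colourOf d j)) + entry (does d) ≡ 1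
    byDistinct (yes _)   = cong (_+ 1) (trans (Σ-const s 0) (*-zeroʳ s))
    byDistinct (no a≢b) = trans (+-identityʳ _) (Σ-δ (column (punchOut a≢b)))

  gridColouring : UniformColouring l s
  gridColouring = record { colour = colour ; classSize = classSize ; partition = partition }

vertexCount : ∀ l s m → m * (suc (l * s) * s) ≡ m * (l * s * s + s)
vertexCount = solve-∀

mainTheorem11 : (l s m : ℕ) → .{{NonZero l}} → .{{NonZero s}} → .{{NonZero m}} →
    DSRG-exists (m * (l * s * s + s)) (m * l * s) (m * l) (m * (l ∸ 1)) (m * l)
    × DSRG-exists (m * (l * s * s + s)) (m * (l * s + s) ∸ 1) (m * (l + s) ∸ 1)
        (m * (l + s) ∸ 2) (m * (l + 1))
mainTheorem11 l s m =
  resize G₁ isDSRG₁ , resize G₂ isDSRG₂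
  where
  open Lift (GridColouring.gridColouring l s) m
  resize : ∀ {k t λ′ μ} (G : Digraph V) → IsDSRG V k t λ′ μ G → DSRG-exists (m * (l * s * s + s)) k t λ′ μ
  resize {k} {t} {λ′} {μ} G isDSRG = subst (λ v → DSRG-exists v k t λ′ μ) (vertexCount l s m) (G , isDSRG)
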